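{- Let $\vec x=\langle x_1,\dots,x_n\rangle$ and $\vec y=\langle y_1,\dots,y_n\rangle$ be lists of variable names of the same length $n$, where the $y_i$ are pairwise distinct (the $x_i$ need not be), and let $t$ be a $\lambda$-term with $\{y_1,\dots,y_n\}\cap\mathrm{FV}(\lambda\vec x.t)=\emptyset$. Then $(\lambda\vec x.t)(\vec y)=\Pi_n(\vec x,\vec y)\cdot t$ (modulo $\alpha\beta$-equivalence).
   Context: $\lambda$-terms: $t::=x\mid c\mid\lambda x.t\mid t_1\,t_2$, treated as concrete named terms; $\lambda\vec x.t=\lambda x_1.\cdots\lambda x_n.t$ and $a(t_1,\dots,t_n)=(\cdots(a\,t_1)\cdots t_n)$. Swapping of variable names: $(x\,y)\cdot x=y$, $(x\,y)\cdot y=x$, $(x\,y)\cdot z=z$ for variables $z\ne x,y$, $(x\,y)\cdot c=c$ for constants, $(x\,y)\cdot(\lambda z.t)=\lambda((x\,y)\cdot z).((x\,y)\cdot t)$, $(x\,y)\cdot a(t_1,\dots,t_n)=((x\,y)\cdot a)((x\,y)\cdot t_1,\dots,(x\,y)\cdot t_n)$; a sequence of swappings acts by applying them right to left. The permutation $\Pi_n$ is defined by $\Pi_1(\langle x\rangle,\langle y\rangle)=(x\,y)$ and $\Pi_n(\langle x_1,\dots,x_n\rangle,\langle y_1,\dots,y_n\rangle)=\Pi_{n-1}(\langle(x_1\,y_1)\cdot x_2,\dots,(x_1\,y_1)\cdot x_n\rangle,\langle y_2,\dots,y_n\rangle)\cdot(x_1\,y_1)$. $\mathrm{FV}$ denotes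 free variables. -}

module Defs where

open import Data.Nat using (ℕ; zero; suc; _≡ᵇ_)
open import Data.Bool using (if_then_else_)
open import Data.List using (List; []; _∷_; _++_; [_])
open import Data.Vec using (Vec; []; _∷_; map)
open import Data.Product using (_×_; _,_)
open import Relation.Binary.PropositionalEquality using (_≡_)
open import Relation.Nullary using (¬_)

Name : Set
Name = ℕ

data Term (C : Set) : Set where
  var : Name → Term C
  con : C → Term C
  lam : Name → Term C → Term C
  app : Term C → Term C → Term C

module _ {C : Set} where

  lams : ∀ {n} → Vec Name n → Term C → Term C
  lams []       t = t
  lams (x ∷ xs) t = lam x (lams xs t)

  apps : ∀ {n} → Term C → Vec Name n → Term C
  apps a []       = a
  apps a (y ∷ ys) = apps (app a (var y)) ys

  data _FreeIn_ (z : Name) : Term C → Set where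
    fv-var : z FreeIn var z
    fv-lam : ∀ {x t} → ¬ (z ≡ x) → z FreeIn t → z FreeIn lam x t
    fv-app₁ : ∀ {t s} → z FreeIn t → z FreeIn app t s
    fv-app₂ : ∀ {t s} → z FreeIn s → z FreeIn app t s

  data _BoundIn_ (z : Name) : Term C → Set where
    bv-here : ∀ {t} → z BoundIn lam z t
    bv-lam : ∀ {x t} → z BoundIn t → z BoundIn lam x t
    bv-app₁ : ∀ {t s} → z BoundIn t → z BoundIn app t s
    bv-app₂ : ∀ {t s} → z BoundIn s → z BoundIn app t s

swapName : Name → Name → Name → Name
swapName x y z = if z ≡ᵇ x then y else (if z ≡ᵇ y then x else z)

-- a permutation given as a list of swappings, applied right to left
Perm : Set
Perm = List (Name × Name)

module _ {C : Set} where

  swap : Name → Name → Term C → Term C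
  swap x y (var z)   = var (swapName x y z)
  swap x y (con c)   = con c
  swap x y (lam z t) = lam (swapName x y z) (swap x y t)
  swap x y (app t s) = app (swap x y t) (swap x y s)

  act : Perm → Term C → Term C
  act []             t = t
  act ((x , y) ∷ ps) t = swap x y (act ps t)

  -- naive substitution t[x := s]; used only when no capture can occur
  subst : Name → Term C → Term C → Term C
  subst x s (var z)   = if z ≡ᵇ x then s else var z
  subst x s (con c)   = con c
  subst x s (lam z t) = if z ≡ᵇ x then lam z t else lam z (subst x s t)
  subst x s (app t u) = app (subst x s t) (subst x s u)

  -- αβ-equivalence: the least congruence (equivalence relation compatible
  -- with λ and application) containing α-renaming and β-reduction.
  -- β uses naive substitution under the capture-avoidance side condition
  -- that no binder of the body is free in the argument (with α available,
  -- this generates the usual αβ-equivalence).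
  data _≈αβ_ : Term C → Term C → Set where
    α    : ∀ {x y t} → ¬ (y FreeIn lam x t) →
           lam x t ≈αβ lam y (swap x y t)
    β    : ∀ {x t s} → (∀ z → z BoundIn t → ¬ (z FreeIn s)) →
           app (lam x t) s ≈αβ subst x s t
    refl  : ∀ {t} → t ≈αβ t
    sym   : ∀ {t u} → t ≈αβ u → u ≈αβ t
    trans : ∀ {t u v} → t ≈αβ u → u ≈αβ v → t ≈αβ v
    cong-lam : ∀ {x t u} → t ≈αβ u → lam x t ≈αβ lam x u
    cong-app : ∀ {t t' s s'} → t ≈αβ t' → s ≈αβ s' → app t s ≈αβ app t' s'

Π : ∀ {n} → Vec Name n → Vec Name n → Perm
Π []       []       = []
Π (x ∷ xs) (y ∷ ys) = Π (map (swapName x y) xs) ys ++ [ (x , y) ]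

-- As y₁ is fresh for λx₁.λx⃗.t, the first β-step is an α-renaming of x₁ to y₁
-- followed by the trivial redex (λy.u) y = u, which yields (x₁ y₁)·λx⃗.t = λ((x₁ y₁)·x⃗).(x₁ y₁)·t.
-- The remaining yᵢ stay fresh for it because they differ from y₁, and the recursion defining Πₙ
-- is exactly the induction hypothesis for (x₁ y₁)·x⃗ and (x₁ y₁)·t followed by the swap (x₁ y₁).
module Submission where

open import Defs
open import Data.Nat using (ℕ; zero; suc; _≡ᵇ_; _⊔_; _≤_; _<_; s≤s)
open import Data.Nat.Properties using (≡ᵇ⇒≡; ≡⇒≡ᵇ; _≟_; m≤m⊔n; m≤n⊔m; ≤-refl; ≤-trans; <⇒≱; >⇒≢)
open import Data.Bool using (true; false)
open import Data.Bool.Properties using (T-≡)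
open import Data.Empty using (⊥-elim)
open import Data.Product using (∃; _×_; _,_)
open import Data.List using ([]; _∷_; _++_; [_])
open import Data.Vec using (Vec; []; _∷_; map)
open import Data.Vec.Relation.Unary.All as All using (All; []; _∷_)
open import Data.Vec.Relation.Unary.Unique.Propositional using (Unique)
open import Data.Vec.Relation.Unary.AllPairs using ([]; _∷_)
open import Function.Bundles using (Equivalence)
open import Relation.Binary.Bundles using (Setoid)
open import Relation.Binary.Structures using (IsEquivalence)
import Relation.Binary.Reasoning.Setoid as SetoidReasoning
open import Relation.Nullary using (¬_; yes; no)
open import Relation.Binary.PropositionalEquality as P using (_≡_; _≢_; cong)

≡⇒≡ᵇ≡true : ∀ m n → m ≡ n → (m ≡ᵇ n) ≡ true
≡⇒≡ᵇ≡true m n m≡n = Equivalence.to T-≡ (≡⇒≡ᵇ m n m≡n)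

≢⇒≡ᵇ≡false : ∀ m n → m ≢ n → (m ≡ᵇ n) ≡ false
≢⇒≡ᵇ≡false m n m≢n with m ≡ᵇ n in eq
... | true  = ⊥-elim (m≢n (≡ᵇ⇒≡ m n (Equivalence.from T-≡ eq)))
... | false = P.refl

swapName-left : ∀ x y → swapName x y x ≡ y
swapName-left x y rewrite ≡⇒≡ᵇ≡true x x P.refl = P.refl

swapName-right : ∀ x y → swapName x y y ≡ x
swapName-right x y with y ≟ x
... | yes P.refl = swapName-left y y
... | no y≢x rewrite ≢⇒≡ᵇ≡false y x y≢x | ≡⇒≡ᵇ≡true y y P.refl = P.refl

swapName-fixes : ∀ x y z → z ≢ x → z ≢ y → swapName x y z ≡ z
swapName-fixes x y z z≢x z≢y rewrite ≢⇒≡ᵇ≡false z x z≢x | ≢⇒≡ᵇ≡false z y z≢y = P.refl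

swapName-involutive : ∀ x y z → swapName x y (swapName x y z) ≡ z
swapName-involutive x y z with z ≟ x | z ≟ y
... | yes P.refl | _ rewrite swapName-left z y = swapName-right z y
... | no _ | yes P.refl rewrite swapName-right x z = swapName-left x z
... | no z≢x | no z≢y rewrite swapName-fixes x y z z≢x z≢y = swapName-fixes x y z z≢x z≢y

module _ {C : Set} where

  ≈αβ-isEquivalence : IsEquivalence (_≈αβ_ {C})
  ≈αβ-isEquivalence = record { refl = refl ; sym = sym ; trans = trans }

  ≈αβ-setoid : Setoid _ _
  ≈αβ-setoid = record { isEquivalence = ≈αβ-isEquivalence }

  swap-lams : ∀ {n} x y (xs : Vec Name n) (t : Term C) →
    swap x y (lams xs t) ≡ lams (map (swapName x y) xs) (swap x y t)
  swap-lams x y []       t = P.refl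
  swap-lams x y (z ∷ xs) t = cong (lam (swapName x y z)) (swap-lams x y xs t)

  act-++ : ∀ p q (t : Term C) → act (p ++ q) t ≡ act p (act q t)
  act-++ []             q t = P.refl
  act-++ ((x , y) ∷ p) q t = cong (swap x y) (act-++ p q t)

  apps-cong : ∀ {n} (ys : Vec Name n) {a b : Term C} → a ≈αβ b → apps a ys ≈αβ apps b ys
  apps-cong []       a≈b = a≈b
  apps-cong (y ∷ ys) a≈b = apps-cong ys (cong-app a≈b refl)

  FreeIn-swap⁻ : ∀ x y (t : Term C) {z} → z FreeIn swap x y t → swapName x y z FreeIn t
  FreeIn-swap⁻ x y (var w) fv-var =
    P.subst (_FreeIn var w) (P.sym (swapName-involutive x y w)) fv-var
  FreeIn-swap⁻ x y (lam w t) {z} (fv-lam z≢w′ p) = fv-lam z′≢w (FreeIn-swap⁻ x y t p)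
    where
    z′≢w : swapName x y z ≢ w
    z′≢w eq = z≢w′ (P.trans (P.sym (swapName-involutive x y z)) (cong (swapName x y) eq))
  FreeIn-swap⁻ x y (app t s) (fv-app₁ p) = fv-app₁ (FreeIn-swap⁻ x y t p)
  FreeIn-swap⁻ x y (app t s) (fv-app₂ p) = fv-app₂ (FreeIn-swap⁻ x y s p)

  BoundIn-swap⁻ : ∀ x y (t : Term C) {z} → z BoundIn swap x y t → swapName x y z BoundIn t
  BoundIn-swap⁻ x y (lam w t) bv-here =
    P.subst (_BoundIn lam w t) (P.sym (swapName-involutive x y w)) bv-here
  BoundIn-swap⁻ x y (lam w t) (bv-lam p)  = bv-lam (BoundIn-swap⁻ x y t p)
  BoundIn-swap⁻ x y (app t s) (bv-app₁ p) = bv-app₁ (BoundIn-swap⁻ x y t p)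
  BoundIn-swap⁻ x y (app t s) (bv-app₂ p) = bv-app₂ (BoundIn-swap⁻ x y s p)

  swap-preserves-∉FV : ∀ {x y z} {t : Term C} → z ≢ y →
    ¬ (y FreeIn lam x t) → ¬ (z FreeIn lam x t) → ¬ (z FreeIn swap x y t)
  swap-preserves-∉FV {x} {y} {z} {t} z≢y y∉ z∉ z∈ with z ≟ x
  ... | yes P.refl = y∉ (fv-lam (λ y≡z → z≢y (P.sym y≡z))
                                (P.subst (_FreeIn t) (swapName-left z y) (FreeIn-swap⁻ z y t z∈)))
  ... | no z≢x = z∉ (fv-lam z≢x (P.subst (_FreeIn t) (swapName-fixes x y z z≢x z≢y) (FreeIn-swap⁻ x y t z∈)))

  maxName : Term C → Name
  maxName (var z)   = z
  maxName (con c)   = 0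
  maxName (lam z t) = z ⊔ maxName t
  maxName (app t s) = maxName t ⊔ maxName s

  FreeIn⇒≤maxName : ∀ {z} {t : Term C} → z FreeIn t → z ≤ maxName t
  FreeIn⇒≤maxName fv-var = ≤-refl
  FreeIn⇒≤maxName {t = lam x t} (fv-lam _ p) = ≤-trans (FreeIn⇒≤maxName p) (m≤n⊔m x (maxName t))
  FreeIn⇒≤maxName {t = app t s} (fv-app₁ p)  = ≤-trans (FreeIn⇒≤maxName p) (m≤m⊔n (maxName t) (maxName s))
  FreeIn⇒≤maxName {t = app t s} (fv-app₂ p)  = ≤-trans (FreeIn⇒≤maxName p) (m≤n⊔m (maxName t) (maxName s))

  BoundIn⇒≤maxName : ∀ {z} {t : Term C} → z BoundIn t → z ≤ maxName t
  BoundIn⇒≤maxName {t = lam x t} bv-here     = m≤m⊔n x (maxName t)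
  BoundIn⇒≤maxName {t = lam x t} (bv-lam p)  = ≤-trans (BoundIn⇒≤maxName p) (m≤n⊔m x (maxName t))
  BoundIn⇒≤maxName {t = app t s} (bv-app₁ p) = ≤-trans (BoundIn⇒≤maxName p) (m≤m⊔n (maxName t) (maxName s))
  BoundIn⇒≤maxName {t = app t s} (bv-app₂ p) = ≤-trans (BoundIn⇒≤maxName p) (m≤n⊔m (maxName t) (maxName s))

  ∉BoundIn-lam : ∀ {x y} {t : Term C} → x ≢ y → ¬ (y BoundIn t) → ¬ (y BoundIn lam x t)
  ∉BoundIn-lam x≢y y∉t bv-here    = x≢y P.refl
  ∉BoundIn-lam x≢y y∉t (bv-lam p) = y∉t p

  ∉BoundIn-app : ∀ {y} {t s : Term C} → ¬ (y BoundIn t) → ¬ (y BoundIn s) → ¬ (y BoundIn app t s)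
  ∉BoundIn-app y∉t y∉s (bv-app₁ p) = y∉t p
  ∉BoundIn-app y∉t y∉s (bv-app₂ p) = y∉s p

  -- Needed because β substitutes naively: (λy.t) y may only be contracted once no binder of t is y.
  rename-binder-away : ∀ y (t : Term C) → ∃ λ t′ → t ≈αβ t′ × ¬ (y BoundIn t′)
  rename-binder-away y (var z) = var z , refl , λ ()
  rename-binder-away y (con c) = con c , refl , λ ()
  rename-binder-away y (app t s) with rename-binder-away y t | rename-binder-away y s
  ... | t′ , t≈t′ , y∉t′ | s′ , s≈s′ , y∉s′ = app t′ s′ , cong-app t≈t′ s≈s′ , ∉BoundIn-app y∉t′ y∉s′
  rename-binder-away y (lam x t) with rename-binder-away y t | x ≟ y
  ... | t′ , t≈t′ , y∉t′ | no x≢y = lam x t′ , cong-lam t≈t′ , ∉BoundIn-lam x≢y y∉t′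
  ... | t′ , t≈t′ , _ | yes P.refl = lam z (swap x z t′) , trans (cong-lam t≈t′) (α z∉) , x∉
    where
    z : Name
    z = suc (x ⊔ maxName t′)
    t′<z : maxName t′ < z
    t′<z = s≤s (m≤n⊔m x (maxName t′))
    z∉ : ¬ (z FreeIn lam x t′)
    z∉ (fv-lam _ p) = <⇒≱ t′<z (FreeIn⇒≤maxName p)
    x∉ : ¬ (x BoundIn lam z (swap x z t′))
    x∉ = ∉BoundIn-lam (>⇒≢ (s≤s (m≤m⊔n x (maxName t′)))) λ p →
           <⇒≱ t′<z (BoundIn⇒≤maxName (P.subst (_BoundIn t′) (swapName-left x z) (BoundIn-swap⁻ x z t′ p)))

  subst-var-self : ∀ y (t : Term C) → subst y (var y) t ≡ t
  subst-var-self y (var z) with z ≡ᵇ y in eq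
  ... | true  = cong var (P.sym (≡ᵇ⇒≡ z y (Equivalence.from T-≡ eq)))
  ... | false = P.refl
  subst-var-self y (con c) = P.refl
  subst-var-self y (lam z t) with z ≡ᵇ y
  ... | true  = P.refl
  ... | false = cong (lam z) (subst-var-self y t)
  subst-var-self y (app t s) = P.cong₂ app (subst-var-self y t) (subst-var-self y s)

  β-var-self : ∀ y (t : Term C) → app (lam y t) (var y) ≈αβ t
  β-var-self y t with rename-binder-away y t
  ... | t′ , t≈t′ , y∉t′ = begin
    app (lam y t) (var y)   ≈⟨ cong-app (cong-lam t≈t′) refl ⟩
    app (lam y t′) (var y)  ≈⟨ β capture-free ⟩
    subst y (var y) t′      ≡⟨ subst-var-self y t′ ⟩
    t′                      ≈⟨ sym t≈t′ ⟩
    t                       ∎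
    where
    open SetoidReasoning ≈αβ-setoid
    capture-free : ∀ z → z BoundIn t′ → ¬ (z FreeIn var y)
    capture-free z z∈t′ fv-var = y∉t′ z∈t′

  β-var-fresh : ∀ {x y} {t : Term C} → ¬ (y FreeIn lam x t) → app (lam x t) (var y) ≈αβ swap x y t
  β-var-fresh {x} {y} {t} y∉ = trans (cong-app (α y∉) refl) (β-var-self y (swap x y t))

lemma6p5 : {C : Set} (n : ℕ) (xs ys : Vec Name n) (t : Term C) →
    Unique ys →
    All (λ y → ¬ (y FreeIn lams xs t)) ys →
    apps (lams xs t) ys ≈αβ act (Π xs ys) t
lemma6p5 zero [] [] t [] [] = refl
lemma6p5 (suc n) (x ∷ xs) (y ∷ ys) t (y∉ys ∷ ys-unique) (y∉ ∷ ys∉) = begin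
  apps (app (lam x (lams xs t)) (var y)) ys ≈⟨ apps-cong ys (β-var-fresh y∉) ⟩
  apps (swap x y (lams xs t)) ys            ≡⟨ cong (λ u → apps u ys) (swap-lams x y xs t) ⟩
  apps (lams xs′ (swap x y t)) ys           ≈⟨ lemma6p5 n xs′ ys (swap x y t) ys-unique ys∉′ ⟩
  act (Π xs′ ys) (swap x y t)               ≡⟨ P.sym (act-++ (Π xs′ ys) [ x , y ] t) ⟩
  act (Π xs′ ys ++ [ x , y ]) t             ∎
  where
  open SetoidReasoning ≈αβ-setoid
  xs′ = map (swapName x y) xs
  ys∉′ : All (λ z → ¬ (z FreeIn lams xs′ (swap x y t))) ys
  ys∉′ = P.subst (λ u → All (λ z → ¬ (z FreeIn u)) ys) (swap-lams x y xs t)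
           (All.map (λ (y≢z , z∉) → swap-preserves-∉FV (λ z≡y → y≢z (P.sym z≡y)) y∉ z∉)
                    (All.zip (y∉ys , ys∉)))
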